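{- On $\{0,1\}$: (1) $\delta_0,\delta_1\in\langle\{\mathrm{IMP}\}\rangle_{\max}$; (2) $\delta_0\in\langle\{\mathrm{NEQ},\delta_1\}\rangle_{\max}$ and $\delta_1\in\langle\{\mathrm{NEQ},\delta_0\}\rangle_{\max}$; (3) $\mathrm{NAND}^k\in\langle\{\mathrm{NAND}^m\}\rangle_{\max}$ for all $1\le k\le m$; (4) $\mathrm{OR}^k\in\langle\{\mathrm{OR}^m\}\rangle_{\max}$ for all $1\le k\le m$.
   Context: Max-implementation: for an $(n+m)$-ary $R$, $\exists_{\max}(y_1,\dots,y_m)R$ consists of those $\mathbf a\in\{0,1\}^n$ whose number of extensions $\mathbf b\in\{0,1\}^m$ with $(\mathbf a,\mathbf b)\in R$ is maximal over all of $\{0,1\}^n$. $\langle\Gamma\rangle_{\max}$ is the smallest set of relations containing $\Gamma$ and $\mathrm{EQ}=\{(0,0),(1,1)\}$, closed under manipulations with variables (renaming, permuting, identifying variables), conjunction and max-implementation. $\delta_0=\{(0)\}$, $\delta_1=\{(1)\}$, $\mathrm{IMP}=\{(0,0),(0,1),(1,1)\}$, $\mathrm{NEQ}=\{(0,1),(1,0)\}$, $\mathrm{OR}^k=\{0,1\}^k\setminus\{(0,\dots,0)\}$, $\mathrm{NAND}^k=\{0,1\}^k\setminus\{(1,\dots,1)\}$. -}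

module Defs where

open import Data.Bool using (Bool; true; false; not; _∧_; _∨_; if_then_else_)
open import Data.Nat using (ℕ; zero; suc; _+_; _≤ᵇ_)
open import Data.Fin using (Fin)
open import Data.Vec using (Vec; []; _∷_; _++_; lookup; tabulate; splitAt)
open import Data.Product using (Σ; _,_; _×_)
open import Data.List using (List)
open import Data.List.Membership.Propositional using (_∈_)
open import Relation.Binary.PropositionalEquality using (_≡_)

-- A Boolean relation of arity n: its (decidable) characteristic function on {0,1}^n.
-- false = 0, true = 1.
BRel : ℕ → Set
BRel n = Vec Bool n → Bool

Lang : Set
Lang = List (Σ ℕ BRel)

count : (m : ℕ) → (Vec Bool m → Bool) → ℕ
count zero    f = if f [] then 1 else 0
count (suc m) f = count m (λ v → f (false ∷ v)) + count m (λ v → f (true ∷ v))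

allB : (n : ℕ) → (Vec Bool n → Bool) → Bool
allB zero    f = f []
allB (suc n) f = allB n (λ v → f (false ∷ v)) ∧ allB n (λ v → f (true ∷ v))

ext# : (n m : ℕ) → BRel (n + m) → Vec Bool n → ℕ
ext# n m R a = count m (λ b → R (a ++ b))

-- ∃_max (y_1..y_m) R : those a whose number of extensions is maximal over all of {0,1}^n
existsMax : (n m : ℕ) → BRel (n + m) → BRel n
existsMax n m R a = allB n (λ a' → ext# n m R a' ≤ᵇ ext# n m R a)

manip : {n k : ℕ} → (Fin n → Fin k) → BRel n → BRel k
manip σ R x = R (tabulate (λ i → lookup x (σ i)))

-- conjunction on disjoint variable sets (shared variables via manip afterwards)
conj : (n m : ℕ) → BRel n → BRel m → BRel (n + m)
conj n m R S x with splitAt n x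
... | (a , b , _) = R a ∧ S b

EQ : BRel 2
EQ (a ∷ b ∷ []) = not (a ∧ not b) ∧ not (b ∧ not a)

-- ⟨Γ⟩_max : smallest set of relations containing Γ and EQ, closed under manipulations
-- with variables, conjunction and max-implementation (relations as sets: closed under
-- extensional equality of characteristic functions).
data ⟨_⟩max (Γ : Lang) : (n : ℕ) → BRel n → Set where
  base  : ∀ {n R} → (n , R) ∈ Γ → ⟨ Γ ⟩max n R
  eq    : ⟨ Γ ⟩max 2 EQ
  man   : ∀ {n k R} (σ : Fin n → Fin k) → ⟨ Γ ⟩max n R → ⟨ Γ ⟩max k (manip σ R)
  and   : ∀ {n m R S} → ⟨ Γ ⟩max n R → ⟨ Γ ⟩max m S → ⟨ Γ ⟩max (n + m) (conj n m R S)
  max   : ∀ {n m R} → ⟨ Γ ⟩max (n + m) R → ⟨ Γ ⟩max n (existsMax n m R)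
  exten : ∀ {n R S} → ⟨ Γ ⟩max n R → (∀ x → R x ≡ S x) → ⟨ Γ ⟩max n S

δ₀ : BRel 1
δ₀ (a ∷ []) = not a

δ₁ : BRel 1
δ₁ (a ∷ []) = a

IMP : BRel 2
IMP (a ∷ b ∷ []) = not a ∨ b

NEQ : BRel 2
NEQ (a ∷ b ∷ []) = (a ∧ not b) ∨ (b ∧ not a)

OR : (k : ℕ) → BRel k
OR zero    [] = false
OR (suc k) (a ∷ v) = a ∨ OR k v

NAND : (k : ℕ) → BRel k
NAND zero    [] = false
NAND (suc k) (a ∷ v) = not a ∨ NAND k v

module Submission where

-- Every part of the lemma is obtained by an explicit expression in the
-- closure operations of ⟨Γ⟩max.
--   (1) In IMP(x,y) the value x = 0 has two extensions y and x = 1 only one, so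
--       ∃max y. IMP(x,y) = δ₀; symmetrically ∃max y. IMP(y,x) = δ₁.
--   (2) In NEQ(x,y) ∧ δ₁(y) the value x = 0 has one extension and x = 1 none, so
--       ∃max y. (NEQ(x,y) ∧ δ₁(y)) = δ₀; dually with δ₀ for δ₁.
--   (3,4) NAND and OR are "disjunctive" families: F(v) holds iff g(vᵢ) holds for some i
--       (g = not, resp. g = id).  Since ∨ is idempotent, identifying the last m − k + 1
--       variables of F^m yields F^k, so no max-implementation is needed here.

open import Defs
open import Data.Nat using (ℕ; _≤_; zero; suc; s≤s; z≤n)
open import Data.Product using (_×_; _,_)
open import Data.List using ([]; _∷_)
open import Data.List.Membership.Propositional using (_∈_)
open import Data.List.Relation.Unary.Any using (here; there)
open import Data.Fin using (Fin; zero; suc)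
open import Data.Bool using (Bool; true; false; not; _∨_)
open import Data.Bool.Properties using (∨-idem; ∨-identityʳ)
open import Data.Vec using (Vec; []; _∷_; tabulate; lookup)
open import Relation.Binary.PropositionalEquality using (_≡_; refl; sym; trans; cong; module ≡-Reasoning)
open ≡-Reasoning

-- Identification of trailing variables: position i of a (1+m)-tuple reads variable
-- min(i, k) of a (1+k)-tuple, i.e. (x₀,…,x_k) ↦ (x₀,…,x_{k-1},x_k,…,x_k).
clampTo : (k m : ℕ) → Fin (suc m) → Fin (suc k)
clampTo k       m       zero    = zero
clampTo zero    m       (suc i) = zero
clampTo (suc k) (suc m) (suc i) = suc (clampTo k m i)

record IsDisjunctive (F : (n : ℕ) → BRel n) (g : Bool → Bool) : Set where
  field
    empty : F zero [] ≡ false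
    step  : ∀ n a v → F (suc n) (a ∷ v) ≡ g a ∨ F n v

NAND-disjunctive : IsDisjunctive NAND not
NAND-disjunctive = record { empty = refl ; step = λ _ _ _ → refl }

OR-disjunctive : IsDisjunctive OR (λ a → a)
OR-disjunctive = record { empty = refl ; step = λ _ _ _ → refl }

module _ {F : (n : ℕ) → BRel n} {g : Bool → Bool} (F-disj : IsDisjunctive F g) where
  open IsDisjunctive F-disj

  -- On a constant tuple (a,…,a) a disjunctive relation reduces to its atom g(a);
  -- this is where idempotence of ∨ enters.
  disjunctive-constant : ∀ n a → F (suc n) (tabulate (λ _ → a)) ≡ g a
  disjunctive-constant zero a = begin
    F (suc zero) (a ∷ [])  ≡⟨ step zero a [] ⟩
    g a ∨ F zero []        ≡⟨ cong (g a ∨_) empty ⟩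
    g a ∨ false            ≡⟨ ∨-identityʳ (g a) ⟩
    g a                    ∎
  disjunctive-constant (suc n) a = begin
    F (suc (suc n)) (a ∷ tabulate (λ _ → a))  ≡⟨ step (suc n) a _ ⟩
    g a ∨ F (suc n) (tabulate (λ _ → a))      ≡⟨ cong (g a ∨_) (disjunctive-constant n a) ⟩
    g a ∨ g a                                 ≡⟨ ∨-idem (g a) ⟩
    g a                                       ∎

  disjunctive-clamp : ∀ {k m} → k ≤ m → (x : Vec Bool (suc k)) →
    F (suc m) (tabulate (λ i → lookup x (clampTo k m i))) ≡ F (suc k) x
  disjunctive-clamp {zero} {m} z≤n (a ∷ []) =
    trans (disjunctive-constant m a) (sym (disjunctive-constant zero a))
  disjunctive-clamp {suc k} {suc m} (s≤s k≤m) (a ∷ x) = begin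
    F (suc (suc m)) (a ∷ tabulate (λ i → lookup x (clampTo k m i)))
      ≡⟨ step (suc m) a _ ⟩
    g a ∨ F (suc m) (tabulate (λ i → lookup x (clampTo k m i)))
      ≡⟨ cong (g a ∨_) (disjunctive-clamp k≤m x) ⟩
    g a ∨ F (suc k) x
      ≡⟨ sym (step (suc k) a x) ⟩
    F (suc (suc k)) (a ∷ x) ∎

  disjunctive-shrink : ∀ {Γ k m} → ⟨ Γ ⟩max (suc m) (F (suc m)) → k ≤ m →
    ⟨ Γ ⟩max (suc k) (F (suc k))
  disjunctive-shrink {k = k} {m} F∈Γ k≤m =
    exten (man (clampTo k m) F∈Γ) (disjunctive-clamp k≤m)

-- A unary relation is determined by its values at 0 and 1; used to identify the
-- max-implemented relations below, whose values are computed by evaluation.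
unary-ext : {R S : BRel 1} → R (false ∷ []) ≡ S (false ∷ []) → R (true ∷ []) ≡ S (true ∷ []) →
  ∀ x → R x ≡ S x
unary-ext at0 at1 (false ∷ []) = at0
unary-ext at0 at1 (true ∷ [])  = at1

swap₂ : Fin 2 → Fin 2
swap₂ zero    = suc zero
swap₂ (suc _) = zero

-- ∃max y. IMP(x,y) = δ₀: x = 0 has the two extensions y = 0, 1, while x = 1 has only y = 1.
δ₀-from-IMP : ∀ {Γ} → (2 , IMP) ∈ Γ → ⟨ Γ ⟩max 1 δ₀
δ₀-from-IMP IMP∈Γ = exten (max {n = 1} {m = 1} (base IMP∈Γ)) (unary-ext refl refl)

-- ∃max y. IMP(y,x) = δ₁: x = 1 has the two extensions y = 0, 1, while x = 0 has only y = 0.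
δ₁-from-IMP : ∀ {Γ} → (2 , IMP) ∈ Γ → ⟨ Γ ⟩max 1 δ₁
δ₁-from-IMP IMP∈Γ = exten (max {n = 1} {m = 1} (man swap₂ (base IMP∈Γ))) (unary-ext refl refl)

-- ∃max y. (NEQ(x,y) ∧ δ₁(y)) = δ₀: x = 0 has the single extension y = 1, x = 1 none.
-- The inner relation is NEQ(x₀,x₁) ∧ δ₁(x₂) with x₂ identified with x₁ via clampTo 1 2.
δ₀-from-NEQ : ∀ {Γ} → (2 , NEQ) ∈ Γ → (1 , δ₁) ∈ Γ → ⟨ Γ ⟩max 1 δ₀
δ₀-from-NEQ NEQ∈Γ δ₁∈Γ =
  exten (max {n = 1} {m = 1} (man (clampTo 1 2) (and (base NEQ∈Γ) (base δ₁∈Γ))))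
        (unary-ext refl refl)

δ₁-from-NEQ : ∀ {Γ} → (2 , NEQ) ∈ Γ → (1 , δ₀) ∈ Γ → ⟨ Γ ⟩max 1 δ₁
δ₁-from-NEQ NEQ∈Γ δ₀∈Γ =
  exten (max {n = 1} {m = 1} (man (clampTo 1 2) (and (base NEQ∈Γ) (base δ₀∈Γ))))
        (unary-ext refl refl)

lemma16 : ((⟨ (2 , IMP) ∷ [] ⟩max 1 δ₀) × (⟨ (2 , IMP) ∷ [] ⟩max 1 δ₁))
    × ((⟨ (2 , NEQ) ∷ (1 , δ₁) ∷ [] ⟩max 1 δ₀) × (⟨ (2 , NEQ) ∷ (1 , δ₀) ∷ [] ⟩max 1 δ₁))
    × ((k m : ℕ) → 1 ≤ k → k ≤ m → ⟨ (m , NAND m) ∷ [] ⟩max k (NAND k))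
    × ((k m : ℕ) → 1 ≤ k → k ≤ m → ⟨ (m , OR m) ∷ [] ⟩max k (OR k))
lemma16 =
    (δ₀-from-IMP (here refl) , δ₁-from-IMP (here refl))
  , (δ₀-from-NEQ (here refl) (there (here refl)) , δ₁-from-NEQ (here refl) (there (here refl)))
  , NAND-shrink
  , OR-shrink
  where
    NAND-shrink : (k m : ℕ) → 1 ≤ k → k ≤ m → ⟨ (m , NAND m) ∷ [] ⟩max k (NAND k)
    NAND-shrink (suc k) (suc m) (s≤s z≤n) (s≤s k≤m) =
      disjunctive-shrink NAND-disjunctive (base (here refl)) k≤m

    OR-shrink : (k m : ℕ) → 1 ≤ k → k ≤ m → ⟨ (m , OR m) ∷ [] ⟩max k (OR k)
    OR-shrink (suc k) (suc m) (s≤s z≤n) (s≤s k≤m) =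
      disjunctive-shrink OR-disjunctive (base (here refl)) k≤m
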